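{- Let $I_n$ be the number of inversion sequences $(a_1,\dots,a_n)$ for which there are no indices $i<j<k$ with $a_j\ne a_k$ and $a_i\ge a_k$ (equivalently, avoiding the patterns $010,101,110,120,201,210$), with $I_0=1$. Let $X\equiv X(z)$ be the unique formal power series root (in $z$) of \[ 1-x-zx+2zx^2+z^2x-z^2x^3=0 . \] Then \[ \sum_{n\ge0} I_n z^n=\frac{(X-1)(1-zX+z^2X)}{zX}=1+z+2z^2+5z^3+15z^4+50z^5+178z^6+663z^7+2552z^8+\cdots. \]
   Context: An inversion sequence of length $n$ is an integer sequence $(a_1,\dots,a_n)$ with $0\le a_i<i$ for all $i$. A pattern is a sequence of non-negative integers containing every value from $0$ to its maximum; a sequence contains a pattern $\sigma$ of length $k$ if some subsequence $a_{i_1}\cdots a_{i_k}$ ($i_1<\dots<i_k$) has the same relative order (including equalities) as $\sigma$, and avoids it otherwise. The empty sequence is the unique inversion sequence of length $0$. -}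

module Defs where

open import Data.Nat as ℕ using (ℕ; zero; suc)
open import Data.Nat.Properties as ℕP using ()
open import Data.Integer as ℤ using (ℤ; +_)
open import Data.Fin as Fin using (Fin)
open import Data.Fin.Properties using (all?)
open import Data.Vec using (Vec; []; _∷ʳ_; lookup)
open import Data.List using (List; []; _∷_; [_]; map; concatMap; upTo; filter; length; foldr)
open import Data.Empty using (⊥)
open import Relation.Nullary using (¬_; Dec; ¬?)
open import Relation.Nullary.Decidable using (_→-dec_)
open import Relation.Nullary.Decidable using (yes; no)
open import Relation.Binary.PropositionalEquality using (_≡_; _≢_)

-- Inversion sequences (0-based positions: entry at position i is ≤ i,
-- i.e. a_{i+1} < i+1 in the paper's 1-based convention).

invSeqs : (n : ℕ) → List (Vec ℕ n)
invSeqs zero    = [ [] ]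
invSeqs (suc n) = concatMap (λ v → map (λ x → v ∷ʳ x) (upTo (suc n))) (invSeqs n)

Avoids : ∀ {n} → Vec ℕ n → Set
Avoids {n} a = ∀ (i j k : Fin n) → i Fin.< j → j Fin.< k →
               lookup a j ≢ lookup a k → lookup a k ℕ.≤ lookup a i → ⊥

avoids? : ∀ {n} (a : Vec ℕ n) → Dec (Avoids a)
avoids? a = all? λ i → all? λ j → all? λ k →
  (i Fin.<? j) →-dec (j Fin.<? k) →-dec ¬? (lookup a j ℕP.≟ lookup a k)
    →-dec (lookup a k ℕP.≤? lookup a i) →-dec no (λ ())

I : ℕ → ℕ
I n = length (filter avoids? (invSeqs n))

Series : Set
Series = ℕ → ℤ

_≈_ : Series → Series → Set
f ≈ g = ∀ n → f n ≡ g n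

infix 4 _≈_
infixl 6 _⊕_ _⊖_
infixl 7 _⊛_

_⊕_ : Series → Series → Series
(f ⊕ g) n = f n ℤ.+ g n

_⊖_ : Series → Series → Series
(f ⊖ g) n = f n ℤ.- g n

_⊛_ : Series → Series → Series
(f ⊛ g) n = foldr ℤ._+_ (+ 0) (map (λ k → f k ℤ.* g (n ℕ.∸ k)) (upTo (suc n)))

const : ℤ → Series
const c zero    = c
const c (suc _) = + 0

𝕫 : Series
𝕫 1 = + 1
𝕫 _ = + 0

ogf : (ℕ → ℕ) → Series
ogf a n = + (a n)

IsRoot : Series → Set
IsRoot X = const (+ 1) ⊖ X ⊖ 𝕫 ⊛ X ⊕ const (+ 2) ⊛ 𝕫 ⊛ X ⊛ X
             ⊕ 𝕫 ⊛ 𝕫 ⊛ X ⊖ 𝕫 ⊛ 𝕫 ⊛ X ⊛ X ⊛ X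
           ≈ const (+ 0)

module Submission where

open import Defs
open import Data.Product using (Σ; _×_)
open import Data.Integer using (+_)

open import Algebra.Bundles using (CommutativeRing)
import Algebra.Solver.Ring
import Algebra.Solver.Ring.AlmostCommutativeRing as ACR
import Algebra.Properties.Group as GroupProperties
open import Data.Bool using (true; false; if_then_else_)
open import Data.Empty using (⊥; ⊥-elim)
open import Data.Fin as Fin using (Fin; inject₁; fromℕ)
import Data.Fin.Properties as FinP
open import Data.Integer as ℤ using (ℤ; _+_; _*_; -_; _-_)
import Data.Integer.Properties as ℤP
open import Data.Integer.Tactic.RingSolver using (solve-∀)
open import Data.List using (List; []; _∷_; _++_; map; foldr; upTo; applyUpTo; concatMap; filter; length)
import Data.List.Properties as ListP
open import Data.Maybe using (Maybe; just; nothing)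
open import Data.Nat as ℕ using (ℕ; zero; suc; _≤_; _<_; z≤n; s≤s; _∸_; _≤?_; _≟_)
import Data.Nat.Properties as ℕP
open import Data.Nat.ListAction using (sum)
import Data.Nat.ListAction.Properties as SumP
open import Data.Product using (_,_; proj₁; proj₂)
open import Data.Product.Function.NonDependent.Propositional using (_×-⇔_)
open import Data.Sum using (_⊎_; inj₁; inj₂)
open import Data.Sum.Function.Propositional using (_⊎-⇔_)
open import Data.Vec using (Vec; []; _∷_; _∷ʳ_; lookup; foldl′; initLast)
import Data.Vec.Properties as VecP
open import Function using (_∘_; _⇔_; mk⇔; Equivalence)
open import Function.Construct.Identity using (⇔-id)
import Function.Properties.Equivalence as ⇔
open import Level using (0ℓ)
open import Relation.Nullary using (¬_; Dec; yes; no; does)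
open import Relation.Nullary.Decidable using (_⊎-dec_; dec-true; dec-false; does-⇔)
open import Relation.Binary.PropositionalEquality

-- After an avoiding prefix the admissible next entries are either a ray {x ≥ lo}
-- or the set {x ≥ T} ∪ {L}, where T is one more than the largest entry so far
-- (tracks-state).  Hence the number of completions depends only on the kind of
-- state and on the number h of admissible values at or above T, and the
-- generating functions Φ h of these numbers satisfy Φ h = 1 + z Φ (h + 1) + z S h,
-- where S h collects the ways of exceeding the current maximum (count-ray,
-- count-rayOr).  Taking second differences in h gives a linear recurrence whose
-- characteristic polynomial has the factor t² − (2X − zX²) t + X when X is the
-- root of the cubic (kernel method), so Φ is the solution of that two-term
-- recurrence with the initial values forced by h = 0, 1.  The generating
-- function of I is Φ 0, and the claimed identity holds modulo the cubic.

∑< : ℕ → (ℕ → ℤ) → ℤ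
∑< zero    f = + 0
∑< (suc n) f = f 0 + ∑< n (f ∘ suc)

∑<-cong : ∀ n {f g : ℕ → ℤ} → (∀ i → i < n → f i ≡ g i) → ∑< n f ≡ ∑< n g
∑<-cong zero    eq = refl
∑<-cong (suc n) eq = cong₂ _+_ (eq 0 (s≤s z≤n)) (∑<-cong n (λ i i<n → eq (suc i) (s≤s i<n)))

∑<-+ : ∀ n (f g : ℕ → ℤ) → ∑< n (λ i → f i + g i) ≡ ∑< n f + ∑< n g
∑<-+ zero    f g = refl
∑<-+ (suc n) f g = trans (cong (_+_ (f 0 + g 0)) (∑<-+ n (f ∘ suc) (g ∘ suc)))
                         (interchange (f 0) (g 0) _ _)
  where
  interchange : ∀ a b c d → (a + b) + (c + d) ≡ (a + c) + (b + d)
  interchange = solve-∀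

∑<-*ˡ : ∀ n c (f : ℕ → ℤ) → ∑< n (λ i → c * f i) ≡ c * ∑< n f
∑<-*ˡ zero    c f = sym (ℤP.*-zeroʳ c)
∑<-*ˡ (suc n) c f = trans (cong (_+_ (c * f 0)) (∑<-*ˡ n c (f ∘ suc)))
                          (sym (ℤP.*-distribˡ-+ c (f 0) _))

∑<-const : ∀ n c → ∑< n (λ _ → c) ≡ + n * c
∑<-const zero    c = sym (ℤP.*-zeroˡ c)
∑<-const (suc n) c = trans (cong (_+_ c) (∑<-const n c)) (sym (ℤP.suc-* (+ n) c))

∑<-zero : ∀ n {f : ℕ → ℤ} → (∀ i → i < n → f i ≡ + 0) → ∑< n f ≡ + 0
∑<-zero n eq = trans (∑<-cong n eq) (trans (∑<-const n (+ 0)) (ℤP.*-zeroʳ (+ n)))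

∑<-++ : ∀ m n (f : ℕ → ℤ) → ∑< (m ℕ.+ n) f ≡ ∑< m f + ∑< n (λ i → f (m ℕ.+ i))
∑<-++ zero    n f = sym (ℤP.+-identityˡ _)
∑<-++ (suc m) n f = trans (cong (_+_ (f 0)) (∑<-++ m n (f ∘ suc)))
                          (sym (ℤP.+-assoc (f 0) _ _))

∑<-point : ∀ {n L} (f : ℕ → ℤ) → L < n → (∀ i → i < n → i ≢ L → f i ≡ + 0) → ∑< n f ≡ f L
∑<-point {suc n} {zero}  f _ off =
  trans (cong (_+_ (f 0)) (∑<-zero n (λ i i<n → off (suc i) (s≤s i<n) λ ())))
        (ℤP.+-identityʳ (f 0))
∑<-point {suc n} {suc L} f (s≤s L<n) off =
  trans (cong₂ _+_ (off 0 (s≤s z≤n) λ ())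
                   (∑<-point (f ∘ suc) L<n (λ i i<n i≢L → off (suc i) (s≤s i<n) (i≢L ∘ ℕP.suc-injective))))
        (ℤP.+-identityˡ (f (suc L)))

foldr-upTo : ∀ n (f : ℕ → ℤ) → foldr _+_ (+ 0) (map f (upTo n)) ≡ ∑< n f
foldr-upTo n f = go n (λ i → i)
  where
  go : ∀ n (g : ℕ → ℕ) → foldr _+_ (+ 0) (map f (applyUpTo g n)) ≡ ∑< n (f ∘ g)
  go zero    g = refl
  go (suc n) g = cong (_+_ (f (g 0))) (go n (g ∘ suc))

sum-upTo : ∀ n (f : ℕ → ℕ) → + sum (map f (upTo n)) ≡ ∑< n (λ i → + f i)
sum-upTo n f = go n (λ i → i)
  where
  go : ∀ n (g : ℕ → ℕ) → + sum (map f (applyUpTo g n)) ≡ ∑< n (λ i → + f (g i))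
  go zero    g = refl
  go (suc n) g = trans (ℤP.pos-+ (f (g 0)) _) (cong (_+_ (+ f (g 0))) (go n (g ∘ suc)))

sum-map-zero : ∀ {A : Set} (f : A → ℕ) xs → (∀ x → f x ≡ 0) → sum (map f xs) ≡ 0
sum-map-zero f []       _  = refl
sum-map-zero f (x ∷ xs) f≡0 = cong₂ ℕ._+_ (f≡0 x) (sum-map-zero f xs f≡0)

sum-map-concatMap : ∀ {A B : Set} (f : B → ℕ) (g : A → List B) xs →
                    sum (map f (concatMap g xs)) ≡ sum (map (λ x → sum (map f (g x))) xs)
sum-map-concatMap f g []       = refl
sum-map-concatMap f g (x ∷ xs) = begin
  sum (map f (g x ++ concatMap g xs))                           ≡⟨ cong sum (ListP.map-++ f (g x) _) ⟩
  sum (map f (g x) ++ map f (concatMap g xs))                   ≡⟨ SumP.sum-++ (map f (g x)) _ ⟩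
  sum (map f (g x)) ℕ.+ sum (map f (concatMap g xs))            ≡⟨ cong (sum (map f (g x)) ℕ.+_) (sum-map-concatMap f g xs) ⟩
  sum (map f (g x)) ℕ.+ sum (map (λ x → sum (map f (g x))) xs)  ∎
  where open ≡-Reasoning

length-filter : ∀ {A : Set} {P : A → Set} (P? : ∀ x → Dec (P x)) xs →
                length (filter P? xs) ≡ sum (map (λ x → if does (P? x) then 1 else 0) xs)
length-filter P? []       = refl
length-filter P? (x ∷ xs) with does (P? x)
... | true  = cong suc (length-filter P? xs)
... | false = length-filter P? xs

-- Formal power series

infix  8 -ˢ_
infixr 7 _·ˢ_

0ˢ 1ˢ : Series
0ˢ = const (+ 0)
1ˢ = const (+ 1)

-ˢ_ : Series → Series
(-ˢ f) n = - f n

_·ˢ_ : ℤ → Series → Series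
(c ·ˢ f) n = c * f n

shift : Series → Series
shift f n = f (suc n)

0ˢ-coeff : ∀ n → 0ˢ n ≡ + 0
0ˢ-coeff zero    = refl
0ˢ-coeff (suc n) = refl

⊛-∑< : ∀ f g n → (f ⊛ g) n ≡ ∑< (suc n) (λ k → f k * g (n ∸ k))
⊛-∑< f g n = foldr-upTo (suc n) (λ k → f k * g (n ∸ k))

⊛-coeff₀ : ∀ f g → (f ⊛ g) 0 ≡ f 0 * g 0
⊛-coeff₀ f g = trans (⊛-∑< f g 0) (ℤP.+-identityʳ _)

⊛-suc : ∀ f g n → (f ⊛ g) (suc n) ≡ f 0 * g (suc n) + (shift f ⊛ g) n
⊛-suc f g n = trans (⊛-∑< f g (suc n)) (cong (_+_ (f 0 * g (suc n))) (sym (⊛-∑< (shift f) g n)))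

⊛-suc′ : ∀ f g n → (f ⊛ g) (suc n) ≡ (f ⊛ shift g) n + f (suc n) * g 0
⊛-suc′ f g zero = begin
  (f ⊛ g) 1                     ≡⟨ ⊛-suc f g 0 ⟩
  f 0 * g 1 + (shift f ⊛ g) 0   ≡⟨ cong (_+_ (f 0 * g 1)) (⊛-coeff₀ (shift f) g) ⟩
  f 0 * g 1 + f 1 * g 0         ≡⟨ cong (_+ f 1 * g 0) (sym (⊛-coeff₀ f (shift g))) ⟩
  (f ⊛ shift g) 0 + f 1 * g 0   ∎
  where open ≡-Reasoning
⊛-suc′ f g (suc n) = begin
  (f ⊛ g) (2 ℕ.+ n)
    ≡⟨ ⊛-suc f g (suc n) ⟩
  f 0 * g (2 ℕ.+ n) + (shift f ⊛ g) (suc n)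
    ≡⟨ cong (_+_ (f 0 * g (2 ℕ.+ n))) (⊛-suc′ (shift f) g n) ⟩
  f 0 * g (2 ℕ.+ n) + ((shift f ⊛ shift g) n + f (2 ℕ.+ n) * g 0)
    ≡⟨ sym (ℤP.+-assoc (f 0 * g (2 ℕ.+ n)) _ _) ⟩
  (f 0 * g (2 ℕ.+ n) + (shift f ⊛ shift g) n) + f (2 ℕ.+ n) * g 0
    ≡⟨ cong (_+ f (2 ℕ.+ n) * g 0) (sym (⊛-suc f (shift g) n)) ⟩
  (f ⊛ shift g) (suc n) + f (2 ℕ.+ n) * g 0 ∎
  where open ≡-Reasoning

⊛-cong : ∀ {f f′ g g′} → f ≈ f′ → g ≈ g′ → f ⊛ g ≈ f′ ⊛ g′
⊛-cong {f} {f′} {g} {g′} f≈f′ g≈g′ n = begin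
  (f ⊛ g) n                                  ≡⟨ ⊛-∑< f g n ⟩
  ∑< (suc n) (λ k → f k * g (n ∸ k))         ≡⟨ ∑<-cong (suc n) (λ k _ → cong₂ _*_ (f≈f′ k) (g≈g′ (n ∸ k))) ⟩
  ∑< (suc n) (λ k → f′ k * g′ (n ∸ k))       ≡⟨ sym (⊛-∑< f′ g′ n) ⟩
  (f′ ⊛ g′) n                                ∎
  where open ≡-Reasoning

⊛-distribʳ : ∀ f g h → (g ⊕ h) ⊛ f ≈ g ⊛ f ⊕ h ⊛ f
⊛-distribʳ f g h n = begin
  ((g ⊕ h) ⊛ f) n                                             ≡⟨ ⊛-∑< (g ⊕ h) f n ⟩
  ∑< (suc n) (λ k → (g k + h k) * f (n ∸ k))                  ≡⟨ ∑<-cong (suc n) (λ k _ → ℤP.*-distribʳ-+ (f (n ∸ k)) (g k) (h k)) ⟩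
  ∑< (suc n) (λ k → g k * f (n ∸ k) + h k * f (n ∸ k))        ≡⟨ ∑<-+ (suc n) (λ k → g k * f (n ∸ k)) (λ k → h k * f (n ∸ k)) ⟩
  ∑< (suc n) (λ k → g k * f (n ∸ k)) + ∑< (suc n) (λ k → h k * f (n ∸ k))
                                                              ≡⟨ sym (cong₂ _+_ (⊛-∑< g f n) (⊛-∑< h f n)) ⟩
  (g ⊛ f ⊕ h ⊛ f) n                                           ∎
  where open ≡-Reasoning

·ˢ-⊛ : ∀ c f g → (c ·ˢ f) ⊛ g ≈ c ·ˢ (f ⊛ g)
·ˢ-⊛ c f g n = begin
  ((c ·ˢ f) ⊛ g) n                                ≡⟨ ⊛-∑< (c ·ˢ f) g n ⟩
  ∑< (suc n) (λ k → c * f k * g (n ∸ k))          ≡⟨ ∑<-cong (suc n) (λ k _ → ℤP.*-assoc c (f k) (g (n ∸ k))) ⟩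
  ∑< (suc n) (λ k → c * (f k * g (n ∸ k)))        ≡⟨ ∑<-*ˡ (suc n) c (λ k → f k * g (n ∸ k)) ⟩
  c * ∑< (suc n) (λ k → f k * g (n ∸ k))          ≡⟨ cong (c *_) (sym (⊛-∑< f g n)) ⟩
  (c ·ˢ (f ⊛ g)) n                                ∎
  where open ≡-Reasoning

const-⊛ : ∀ c f → const c ⊛ f ≈ c ·ˢ f
const-⊛ c f zero    = ⊛-coeff₀ (const c) f
const-⊛ c f (suc n) = begin
  (const c ⊛ f) (suc n)                     ≡⟨ ⊛-suc (const c) f n ⟩
  c * f (suc n) + (shift (const c) ⊛ f) n   ≡⟨ cong (_+_ (c * f (suc n))) shifted-vanishes ⟩
  c * f (suc n) + + 0                       ≡⟨ ℤP.+-identityʳ _ ⟩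
  c * f (suc n)                             ∎
  where
  open ≡-Reasoning
  shifted-vanishes : (shift (const c) ⊛ f) n ≡ + 0
  shifted-vanishes = trans (⊛-∑< (shift (const c)) f n)
                           (∑<-zero (suc n) (λ k _ → ℤP.*-zeroˡ (f (n ∸ k))))

⊛-comm : ∀ f g → f ⊛ g ≈ g ⊛ f
⊛-comm f g zero = begin
  (f ⊛ g) 0   ≡⟨ ⊛-coeff₀ f g ⟩
  f 0 * g 0   ≡⟨ ℤP.*-comm (f 0) (g 0) ⟩
  g 0 * f 0   ≡⟨ sym (⊛-coeff₀ g f) ⟩
  (g ⊛ f) 0   ∎
  where open ≡-Reasoning
⊛-comm f g (suc n) = begin
  (f ⊛ g) (suc n)                     ≡⟨ ⊛-suc f g n ⟩
  f 0 * g (suc n) + (shift f ⊛ g) n   ≡⟨ cong (_+_ (f 0 * g (suc n))) (⊛-comm (shift f) g n) ⟩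
  f 0 * g (suc n) + (g ⊛ shift f) n   ≡⟨ ℤP.+-comm (f 0 * g (suc n)) _ ⟩
  (g ⊛ shift f) n + f 0 * g (suc n)   ≡⟨ cong (_+_ ((g ⊛ shift f) n)) (ℤP.*-comm (f 0) (g (suc n))) ⟩
  (g ⊛ shift f) n + g (suc n) * f 0   ≡⟨ sym (⊛-suc′ g f n) ⟩
  (g ⊛ f) (suc n)                     ∎
  where open ≡-Reasoning

⊛-distribˡ : ∀ f g h → f ⊛ (g ⊕ h) ≈ f ⊛ g ⊕ f ⊛ h
⊛-distribˡ f g h n = begin
  (f ⊛ (g ⊕ h)) n            ≡⟨ ⊛-comm f (g ⊕ h) n ⟩
  ((g ⊕ h) ⊛ f) n            ≡⟨ ⊛-distribʳ f g h n ⟩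
  (g ⊛ f) n + (h ⊛ f) n      ≡⟨ cong₂ _+_ (⊛-comm g f n) (⊛-comm h f n) ⟩
  (f ⊛ g) n + (f ⊛ h) n      ∎
  where open ≡-Reasoning

⊛-assoc : ∀ f g h → (f ⊛ g) ⊛ h ≈ f ⊛ (g ⊛ h)
⊛-assoc f g h zero = begin
  ((f ⊛ g) ⊛ h) 0       ≡⟨ ⊛-coeff₀ (f ⊛ g) h ⟩
  (f ⊛ g) 0 * h 0       ≡⟨ cong (_* h 0) (⊛-coeff₀ f g) ⟩
  f 0 * g 0 * h 0       ≡⟨ ℤP.*-assoc (f 0) (g 0) (h 0) ⟩
  f 0 * (g 0 * h 0)     ≡⟨ cong (f 0 *_) (sym (⊛-coeff₀ g h)) ⟩
  f 0 * (g ⊛ h) 0       ≡⟨ sym (⊛-coeff₀ f (g ⊛ h)) ⟩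
  (f ⊛ (g ⊛ h)) 0       ∎
  where open ≡-Reasoning
⊛-assoc f g h (suc n) = begin
  ((f ⊛ g) ⊛ h) (suc n)
    ≡⟨ ⊛-suc (f ⊛ g) h n ⟩
  (f ⊛ g) 0 * h (suc n) + (shift (f ⊛ g) ⊛ h) n
    ≡⟨ cong₂ _+_ (cong (_* h (suc n)) (⊛-coeff₀ f g)) shifted ⟩
  f 0 * g 0 * h (suc n) + (f 0 * (shift g ⊛ h) n + (shift f ⊛ (g ⊛ h)) n)
    ≡⟨ regroup (f 0) (g 0) (h (suc n)) _ _ ⟩
  f 0 * (g 0 * h (suc n) + (shift g ⊛ h) n) + (shift f ⊛ (g ⊛ h)) n
    ≡⟨ cong (λ t → f 0 * t + (shift f ⊛ (g ⊛ h)) n) (sym (⊛-suc g h n)) ⟩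
  f 0 * (g ⊛ h) (suc n) + (shift f ⊛ (g ⊛ h)) n
    ≡⟨ sym (⊛-suc f (g ⊛ h) n) ⟩
  (f ⊛ (g ⊛ h)) (suc n) ∎
  where
  open ≡-Reasoning
  regroup : ∀ a b c d e → a * b * c + (a * d + e) ≡ a * (b * c + d) + e
  regroup = solve-∀
  shift-⊛ : shift (f ⊛ g) ≈ f 0 ·ˢ shift g ⊕ shift f ⊛ g
  shift-⊛ = ⊛-suc f g
  shifted : (shift (f ⊛ g) ⊛ h) n ≡ f 0 * (shift g ⊛ h) n + (shift f ⊛ (g ⊛ h)) n
  shifted = begin
    (shift (f ⊛ g) ⊛ h) n                               ≡⟨ ⊛-cong {g = h} {g′ = h} shift-⊛ (λ _ → refl) n ⟩
    ((f 0 ·ˢ shift g ⊕ shift f ⊛ g) ⊛ h) n              ≡⟨ ⊛-distribʳ h (f 0 ·ˢ shift g) (shift f ⊛ g) n ⟩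
    ((f 0 ·ˢ shift g) ⊛ h) n + ((shift f ⊛ g) ⊛ h) n    ≡⟨ cong₂ _+_ (·ˢ-⊛ (f 0) (shift g) h n) (⊛-assoc (shift f) g h n) ⟩
    f 0 * (shift g ⊛ h) n + (shift f ⊛ (g ⊛ h)) n       ∎

SeriesRing : CommutativeRing 0ℓ 0ℓ
SeriesRing = record
  { Carrier = Series ; _≈_ = _≈_ ; _+_ = _⊕_ ; _*_ = _⊛_ ; -_ = -ˢ_ ; 0# = 0ˢ ; 1# = 1ˢ
  ; isCommutativeRing = record
    { isRing = record
      { +-isAbelianGroup = record
        { isGroup = record
          { isMonoid = record
            { isSemigroup = record
              { isMagma = record
                { isEquivalence = record
                  { refl = λ _ → refl ; sym = λ e n → sym (e n) ; trans = λ e e′ n → trans (e n) (e′ n) }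
                ; ∙-cong = λ e e′ n → cong₂ _+_ (e n) (e′ n) }
              ; assoc = λ f g h n → ℤP.+-assoc (f n) (g n) (h n) }
            ; identity = (λ f n → trans (cong (_+ f n) (0ˢ-coeff n)) (ℤP.+-identityˡ (f n)))
                       , (λ f n → trans (cong (_+_ (f n)) (0ˢ-coeff n)) (ℤP.+-identityʳ (f n))) }
          ; inverse = (λ f n → trans (ℤP.+-inverseˡ (f n)) (sym (0ˢ-coeff n)))
                    , (λ f n → trans (ℤP.+-inverseʳ (f n)) (sym (0ˢ-coeff n)))
          ; ⁻¹-cong = λ e n → cong -_ (e n) }
        ; comm = λ f g n → ℤP.+-comm (f n) (g n) }
      ; *-cong = ⊛-cong
      ; *-assoc = ⊛-assoc
      ; *-identity = (λ f n → trans (const-⊛ (+ 1) f n) (ℤP.*-identityˡ (f n)))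
                   , (λ f n → trans (⊛-comm f 1ˢ n) (trans (const-⊛ (+ 1) f n) (ℤP.*-identityˡ (f n))))
      ; distrib = ⊛-distribˡ , ⊛-distribʳ }
    ; *-comm = ⊛-comm } }

module SeriesRing = CommutativeRing SeriesRing

constHom : ℤ.+-*-rawRing ACR.-Raw-AlmostCommutative⟶ ACR.fromCommutativeRing SeriesRing
constHom = record
  { ⟦_⟧    = const
  ; +-homo = λ { a b zero → refl ; a b (suc n) → refl }
  ; *-homo = λ a b n → sym (trans (const-⊛ a (const b) n) (*-const a b n))
  ; -‿homo = λ { a zero → refl ; a (suc n) → refl }
  ; 0-homo = λ _ → refl
  ; 1-homo = λ _ → refl }
  where
  *-const : ∀ a b n → a * const b n ≡ const (a * b) n
  *-const a b zero    = refl
  *-const a b (suc n) = ℤP.*-zeroʳ a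

const≟ : ∀ a b → Maybe (const a ≈ const b)
const≟ a b with a ℤP.≟ b
... | yes refl = just (λ _ → refl)
... | no _     = nothing

module SeriesSolver = Algebra.Solver.Ring ℤ.+-*-rawRing (ACR.fromCommutativeRing SeriesRing) constHom const≟
open SeriesSolver using (solve; _:=_; _:+_; _:-_; _:*_; con)

open GroupProperties SeriesRing.+-group using (x∙y⁻¹≈ε⇒x≈y; ε⁻¹≈ε)

⊕-≈0ˢ : ∀ {f g} → f ≈ 0ˢ → g ≈ 0ˢ → f ⊕ g ≈ 0ˢ
⊕-≈0ˢ f≈0 g≈0 = SeriesRing.trans (SeriesRing.+-cong f≈0 g≈0) (SeriesRing.+-identityˡ 0ˢ)

-ˢ-≈0ˢ : ∀ {f} → f ≈ 0ˢ → -ˢ f ≈ 0ˢ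
-ˢ-≈0ˢ f≈0 = SeriesRing.trans (SeriesRing.-‿cong f≈0) ε⁻¹≈ε

⊛-≈0ˢ : ∀ p {f} → f ≈ 0ˢ → p ⊛ f ≈ 0ˢ
⊛-≈0ˢ p f≈0 = SeriesRing.trans (SeriesRing.*-congˡ {p} f≈0) (SeriesRing.zeroʳ p)

⊖-≈0ˢ : ∀ {f g} → f ≈ g → f ⊖ g ≈ 0ˢ
⊖-≈0ˢ {f} {g} f≈g n = trans (cong (_- g n) (f≈g n)) (trans (ℤP.+-inverseʳ (g n)) (sym (0ˢ-coeff n)))

𝕫⊛-coeff₀ : ∀ f → (𝕫 ⊛ f) 0 ≡ + 0
𝕫⊛-coeff₀ f = trans (⊛-coeff₀ 𝕫 f) (ℤP.*-zeroˡ (f 0))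

𝕫⊛-suc : ∀ f n → (𝕫 ⊛ f) (suc n) ≡ f n
𝕫⊛-suc f n = begin
  (𝕫 ⊛ f) (suc n)                  ≡⟨ ⊛-suc 𝕫 f n ⟩
  + 0 * f (suc n) + (shift 𝕫 ⊛ f) n ≡⟨ cong (_+ (shift 𝕫 ⊛ f) n) (ℤP.*-zeroˡ (f (suc n))) ⟩
  + 0 + (shift 𝕫 ⊛ f) n             ≡⟨ ℤP.+-identityˡ _ ⟩
  (shift 𝕫 ⊛ f) n                   ≡⟨ ⊛-cong {g = f} {g′ = f} shift-𝕫 (λ _ → refl) n ⟩
  (1ˢ ⊛ f) n                        ≡⟨ SeriesRing.*-identityˡ f n ⟩
  f n                               ∎
  where
  open ≡-Reasoning
  shift-𝕫 : shift 𝕫 ≈ 1ˢ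
  shift-𝕫 zero    = refl
  shift-𝕫 (suc n) = refl

𝕫⊛shift : ∀ f {c} → f 0 ≡ c → 𝕫 ⊛ shift f ≈ f ⊖ const c
𝕫⊛shift f refl zero    = trans (𝕫⊛-coeff₀ (shift f)) (sym (ℤP.+-inverseʳ (f 0)))
𝕫⊛shift f refl (suc n) = trans (𝕫⊛-suc (shift f) n) (sym (ℤP.+-identityʳ (f (suc n))))

𝕫⊛-cancel : ∀ f → 𝕫 ⊛ f ≈ 0ˢ → f ≈ 0ˢ
𝕫⊛-cancel f 𝕫f≈0 n = trans (sym (𝕫⊛-suc f n)) (trans (𝕫f≈0 (suc n)) (sym (0ˢ-coeff n)))

infix 4 _≈[<_]_

_≈[<_]_ : Series → ℕ → Series → Set
f ≈[< n ] g = ∀ m → m < n → f m ≡ g m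

≈[<]-refl : ∀ {n} f → f ≈[< n ] f
≈[<]-refl f _ _ = refl

≈[<]-⊕ : ∀ {n f f′ g g′} → f ≈[< n ] f′ → g ≈[< n ] g′ → f ⊕ g ≈[< n ] f′ ⊕ g′
≈[<]-⊕ f≈f′ g≈g′ m m<n = cong₂ _+_ (f≈f′ m m<n) (g≈g′ m m<n)

≈[<]-⊖ : ∀ {n f f′ g g′} → f ≈[< n ] f′ → g ≈[< n ] g′ → f ⊖ g ≈[< n ] f′ ⊖ g′
≈[<]-⊖ f≈f′ g≈g′ m m<n = cong₂ _-_ (f≈f′ m m<n) (g≈g′ m m<n)

≈[<]-⊛ : ∀ {n f f′ g g′} → f ≈[< n ] f′ → g ≈[< n ] g′ → f ⊛ g ≈[< n ] f′ ⊛ g′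
≈[<]-⊛ {n} {f} {f′} {g} {g′} f≈f′ g≈g′ m m<n = begin
  (f ⊛ g) m                             ≡⟨ ⊛-∑< f g m ⟩
  ∑< (suc m) (λ k → f k * g (m ∸ k))    ≡⟨ ∑<-cong (suc m) termwise ⟩
  ∑< (suc m) (λ k → f′ k * g′ (m ∸ k))  ≡⟨ sym (⊛-∑< f′ g′ m) ⟩
  (f′ ⊛ g′) m                           ∎
  where
  open ≡-Reasoning
  termwise : ∀ k → k < suc m → f k * g (m ∸ k) ≡ f′ k * g′ (m ∸ k)
  termwise k k≤m = cong₂ _*_ (f≈f′ k (ℕP.≤-<-trans (ℕP.≤-pred k≤m) m<n))
                             (g≈g′ (m ∸ k) (ℕP.≤-<-trans (ℕP.m∸n≤m m k) m<n))

≈[<]-𝕫⊛ : ∀ {n f g} → f ≈[< n ] g → 𝕫 ⊛ f ≈[< suc n ] 𝕫 ⊛ g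
≈[<]-𝕫⊛ {f = f} {g} f≈g zero    _         = trans (𝕫⊛-coeff₀ f) (sym (𝕫⊛-coeff₀ g))
≈[<]-𝕫⊛ {f = f} {g} f≈g (suc m) (s≤s m<n) = trans (𝕫⊛-suc f m) (trans (f≈g m m<n) (sym (𝕫⊛-suc g m)))

≈[<]-extend : ∀ {n f g} → f ≈[< n ] g → f n ≡ g n → f ≈[< suc n ] g
≈[<]-extend f≈g fn≡gn m m<1+n with ℕP.m<1+n⇒m<n∨m≡n m<1+n
... | inj₁ m<n  = f≈g m m<n
... | inj₂ refl = fn≡gn

≈-from-≈[<] : ∀ {f g} → (∀ n → f ≈[< n ] g) → f ≈ g
≈-from-≈[<] f≈g n = f≈g (suc n) n ℕP.≤-refl

module Contraction (F : Series → Series)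
                   (contracting : ∀ {n f g} → f ≈[< n ] g → F f ≈[< suc n ] F g) where

  iterate : ℕ → Series → Series
  iterate zero    f = f
  iterate (suc k) f = F (iterate k f)

  iterate-agrees : ∀ k f g → iterate k f ≈[< k ] iterate k g
  iterate-agrees zero    f g m ()
  iterate-agrees (suc k) f g = contracting (iterate-agrees k f g)

  iterate-+ : ∀ k j f → iterate (k ℕ.+ j) f ≡ iterate k (iterate j f)
  iterate-+ zero    j f = refl
  iterate-+ (suc k) j f = cong F (iterate-+ k j f)

  fix : Series
  fix n = iterate (suc n) 0ˢ n

  fix-agrees : ∀ n → fix ≈[< n ] iterate n 0ˢ
  fix-agrees n m m<n = begin
    iterate (suc m) 0ˢ m                              ≡⟨ iterate-agrees (suc m) 0ˢ _ m ℕP.≤-refl ⟩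
    iterate (suc m) (iterate (n ∸ suc m) 0ˢ) m        ≡⟨ cong (λ h → h m) (sym (iterate-+ (suc m) (n ∸ suc m) 0ˢ)) ⟩
    iterate (suc m ℕ.+ (n ∸ suc m)) 0ˢ m              ≡⟨ cong (λ k → iterate k 0ˢ m) (ℕP.m+[n∸m]≡n m<n) ⟩
    iterate n 0ˢ m                                    ∎
    where open ≡-Reasoning

  fix-isFixed : fix ≈ F fix
  fix-isFixed n = sym (contracting (fix-agrees n) n ℕP.≤-refl)

  fix-unique : ∀ g → g ≈ F g → g ≈ fix
  fix-unique g g≈Fg = ≈-from-≈[<] agrees
    where
    agrees : ∀ n → g ≈[< n ] fix
    agrees zero    m ()
    agrees (suc n) m m<1+n = trans (g≈Fg m) (trans (contracting (agrees n) m m<1+n) (sym (fix-isFixed m)))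

⊛-cancelˡ : ∀ f g → f 0 ≡ + 1 → f ⊛ g ≈ 0ˢ → g ≈ 0ˢ
⊛-cancelˡ f g f₀≡1 fg≈0 = ≈-from-≈[<] vanishes
  where
  open ≡-Reasoning
  vanishes : ∀ n → g ≈[< n ] 0ˢ
  coeff : ∀ n → g ≈[< n ] 0ˢ → g n ≡ 0ˢ n
  vanishes zero    m ()
  vanishes (suc n) = ≈[<]-extend (vanishes n) (coeff n (vanishes n))
  coeff zero    _ = begin
    g 0           ≡⟨ sym (ℤP.*-identityˡ (g 0)) ⟩
    + 1 * g 0     ≡⟨ cong (_* g 0) (sym f₀≡1) ⟩
    f 0 * g 0     ≡⟨ sym (⊛-coeff₀ f g) ⟩
    (f ⊛ g) 0     ≡⟨ fg≈0 0 ⟩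
    + 0           ∎
  coeff (suc n) g≈0 = begin
    g (suc n)                                 ≡⟨ sym (ℤP.+-identityʳ _) ⟩
    g (suc n) + + 0                           ≡⟨ cong₂ _+_ (sym (ℤP.*-identityˡ (g (suc n)))) (sym tail-vanishes) ⟩
    + 1 * g (suc n) + (shift f ⊛ g) n         ≡⟨ cong (λ c → c * g (suc n) + (shift f ⊛ g) n) (sym f₀≡1) ⟩
    f 0 * g (suc n) + (shift f ⊛ g) n         ≡⟨ sym (⊛-suc f g n) ⟩
    (f ⊛ g) (suc n)                           ≡⟨ fg≈0 (suc n) ⟩
    + 0                                       ∎
    where
    tail-vanishes : (shift f ⊛ g) n ≡ + 0
    tail-vanishes = trans (≈[<]-⊛ {suc n} (≈[<]-refl (shift f)) g≈0 n ℕP.≤-refl)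
                          (trans (SeriesRing.zeroʳ (shift f) n) (0ˢ-coeff n))

cubic : Series → Series
cubic A = const (+ 1) ⊖ A ⊖ 𝕫 ⊛ A ⊕ const (+ 2) ⊛ 𝕫 ⊛ A ⊛ A ⊕ 𝕫 ⊛ 𝕫 ⊛ A ⊖ 𝕫 ⊛ 𝕫 ⊛ A ⊛ A ⊛ A

rootMap : Series → Series
rootMap A = 1ˢ ⊕ 𝕫 ⊛ (const (+ 2) ⊛ A ⊛ A ⊕ 𝕫 ⊛ A ⊖ A ⊖ 𝕫 ⊛ A ⊛ A ⊛ A)

cubic≈rootMap⊖id : ∀ A → cubic A ≈ rootMap A ⊖ A
cubic≈rootMap⊖id A = solve 2
  (λ a z → con (+ 1) :- a :- z :* a :+ con (+ 2) :* z :* a :* a :+ z :* z :* a :- z :* z :* a :* a :* a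
        := con (+ 1) :+ z :* (con (+ 2) :* a :* a :+ z :* a :- a :- z :* a :* a :* a) :- a)
  SeriesRing.refl A 𝕫

rootMap-contracting : ∀ {n f g} → f ≈[< n ] g → rootMap f ≈[< suc n ] rootMap g
rootMap-contracting {n} f≈g =
  ≈[<]-⊕ (≈[<]-refl 1ˢ) (≈[<]-𝕫⊛
    (≈[<]-⊖ (≈[<]-⊖ (≈[<]-⊕ (≈[<]-⊛ (≈[<]-⊛ (≈[<]-refl {n} (const (+ 2))) f≈g) f≈g)
                            (≈[<]-⊛ (≈[<]-refl 𝕫) f≈g))
                    f≈g)
            (≈[<]-⊛ (≈[<]-⊛ (≈[<]-⊛ (≈[<]-refl {n} 𝕫) f≈g) f≈g) f≈g)))

open Contraction rootMap rootMap-contracting using (fix; fix-isFixed; fix-unique)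

X : Series
X = fix

X-isRoot : IsRoot X
X-isRoot = SeriesRing.trans (cubic≈rootMap⊖id X) (⊖-≈0ˢ (SeriesRing.sym fix-isFixed))

X-unique : ∀ Y → IsRoot Y → Y ≈ X
X-unique Y root = fix-unique Y (SeriesRing.sym (x∙y⁻¹≈ε⇒x≈y (rootMap Y) Y rootMap-Y⊖Y≈0))
  where
  rootMap-Y⊖Y≈0 : rootMap Y ⊖ Y ≈ 0ˢ
  rootMap-Y⊖Y≈0 = SeriesRing.trans (SeriesRing.sym (cubic≈rootMap⊖id Y)) root

X-coeff₀ : X 0 ≡ + 1
X-coeff₀ = trans (fix-isFixed 0) (cong (_+_ (+ 1)) (𝕫⊛-coeff₀ (const (+ 2) ⊛ X ⊛ X ⊕ 𝕫 ⊛ X ⊖ X ⊖ 𝕫 ⊛ X ⊛ X ⊛ X)))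

-- The solution Φ of the functional equation

-- Φ₁ = (X − 1)(1 − zX)/z, see 𝕫⊛Φ₁.
Φ₁ : Series
Φ₁ = shift X ⊛ (1ˢ ⊖ 𝕫 ⊛ X)

Φ : ℕ → Series
Φ zero          = 1ˢ ⊕ 𝕫 ⊛ Φ₁
Φ (suc zero)    = Φ₁
Φ (suc (suc h)) = (const (+ 2) ⊛ X ⊖ 𝕫 ⊛ X ⊛ X) ⊛ Φ (suc h) ⊖ X ⊛ Φ h

-- S h = ∑_{j<h} Ψ (h ∸ j) j (S-∑<), defined here through its differences.
W : ℕ → Series
W zero    = 0ˢ
W (suc h) = Φ (suc (suc h)) ⊕ W h

S : ℕ → Series
S zero    = 0ˢ
S (suc h) = Φ (suc h) ⊕ S h ⊕ 𝕫 ⊛ W h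

defect : ℕ → Series
defect h = 1ˢ ⊕ 𝕫 ⊛ Φ (suc h) ⊕ 𝕫 ⊛ S h ⊖ Φ h

Δ²defect : ℕ → Series
Δ²defect h = 𝕫 ⊛ Φ (3 ℕ.+ h) ⊖ (1ˢ ⊕ 𝕫 ⊖ 𝕫 ⊛ 𝕫) ⊛ Φ (2 ℕ.+ h) ⊕ const (+ 2) ⊛ Φ (suc h) ⊖ Φ h

defect-Δ² : ∀ h → defect (2 ℕ.+ h) ≈ const (+ 2) ⊛ defect (suc h) ⊖ defect h ⊕ Δ²defect h
defect-Δ² h = solve 7
  (λ p₀ p₁ p₂ p₃ s w z →
     let S₁ = p₁ :+ s :+ z :* w
         S₂ = p₂ :+ S₁ :+ z :* (p₂ :+ w)
     in con (+ 1) :+ z :* p₃ :+ z :* S₂ :- p₂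
        := con (+ 2) :* (con (+ 1) :+ z :* p₂ :+ z :* S₁ :- p₁) :- (con (+ 1) :+ z :* p₁ :+ z :* s :- p₀)
           :+ (z :* p₃ :- (con (+ 1) :+ z :- z :* z) :* p₂ :+ con (+ 2) :* p₁ :- p₀))
  SeriesRing.refl (Φ h) (Φ (1 ℕ.+ h)) (Φ (2 ℕ.+ h)) (Φ (3 ℕ.+ h)) (S h) (W h) 𝕫

-- X (z t³ − (1 + z − z²) t² + 2t − 1)
--   = (zX t − 1) (t² − (2X − zX²) t + X) + t² · cubic X.
X⊛Δ²defect : ∀ h → X ⊛ Δ²defect h ≈ cubic X ⊛ Φ (2 ℕ.+ h)
X⊛Δ²defect h = solve 4
  (λ p₀ p₁ x z →
     let a  = con (+ 2) :* x :- z :* x :* x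
         p₂ = a :* p₁ :- x :* p₀
         p₃ = a :* p₂ :- x :* p₁
     in x :* (z :* p₃ :- (con (+ 1) :+ z :- z :* z) :* p₂ :+ con (+ 2) :* p₁ :- p₀)
        := (con (+ 1) :- x :- z :* x :+ con (+ 2) :* z :* x :* x :+ z :* z :* x :- z :* z :* x :* x :* x) :* p₂)
  SeriesRing.refl (Φ h) (Φ (suc h)) X 𝕫

Δ²defect≈0 : ∀ h → Δ²defect h ≈ 0ˢ
Δ²defect≈0 h = ⊛-cancelˡ X (Δ²defect h) X-coeff₀
  (SeriesRing.trans (X⊛Δ²defect h) (SeriesRing.trans (SeriesRing.*-congʳ {Φ (2 ℕ.+ h)} X-isRoot) (SeriesRing.zeroˡ (Φ (2 ℕ.+ h)))))

𝕫⊛Φ₁ : 𝕫 ⊛ Φ₁ ≈ (X ⊖ 1ˢ) ⊛ (1ˢ ⊖ 𝕫 ⊛ X)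
𝕫⊛Φ₁ = SeriesRing.trans (SeriesRing.sym (SeriesRing.*-assoc 𝕫 (shift X) (1ˢ ⊖ 𝕫 ⊛ X)))
                        (SeriesRing.*-congʳ {1ˢ ⊖ 𝕫 ⊛ X} (𝕫⊛shift X X-coeff₀))

defect₀≈0 : defect 0 ≈ 0ˢ
defect₀≈0 = solve 2 (λ p z → con (+ 1) :+ z :* p :+ z :* con (+ 0) :- (con (+ 1) :+ z :* p) := con (+ 0))
                    SeriesRing.refl Φ₁ 𝕫

defect₁≈0 : defect 1 ≈ 0ˢ
defect₁≈0 = 𝕫⊛-cancel (defect 1)
  (SeriesRing.trans 𝕫⊛defect₁ (⊕-≈0ˢ (⊛-≈0ˢ (1ˢ ⊖ 𝕫 ⊛ X) X-isRoot) (⊛-≈0ˢ r (⊖-≈0ˢ 𝕫⊛Φ₁))))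
  where
  r : Series
  r = const (+ 2) ⊛ 𝕫 ⊛ X ⊖ 𝕫 ⊛ 𝕫 ⊛ X ⊛ X ⊖ 𝕫 ⊛ 𝕫 ⊛ X ⊕ 𝕫 ⊖ 1ˢ
  𝕫⊛defect₁ : 𝕫 ⊛ defect 1 ≈ (1ˢ ⊖ 𝕫 ⊛ X) ⊛ cubic X ⊕ r ⊛ (𝕫 ⊛ Φ₁ ⊖ (X ⊖ 1ˢ) ⊛ (1ˢ ⊖ 𝕫 ⊛ X))
  𝕫⊛defect₁ = solve 3
    (λ p x z →
       let a  = con (+ 2) :* x :- z :* x :* x
           p₀ = con (+ 1) :+ z :* p
           p₂ = a :* p :- x :* p₀
           S₁ = p :+ con (+ 0) :+ z :* con (+ 0)
       in z :* (con (+ 1) :+ z :* p₂ :+ z :* S₁ :- p)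
          := (con (+ 1) :- z :* x)
               :* (con (+ 1) :- x :- z :* x :+ con (+ 2) :* z :* x :* x :+ z :* z :* x :- z :* z :* x :* x :* x)
             :+ (con (+ 2) :* z :* x :- z :* z :* x :* x :- z :* z :* x :+ z :- con (+ 1))
               :* (z :* p :- (x :- con (+ 1)) :* (con (+ 1) :- z :* x)))
    SeriesRing.refl Φ₁ X 𝕫

defect≈0 : ∀ h → defect h ≈ 0ˢ
defect≈0 zero          = defect₀≈0
defect≈0 (suc zero)    = defect₁≈0
defect≈0 (suc (suc h)) = SeriesRing.trans (defect-Δ² h)
  (⊕-≈0ˢ (⊕-≈0ˢ (⊛-≈0ˢ (const (+ 2)) (defect≈0 (suc h))) (-ˢ-≈0ˢ (defect≈0 h))) (Δ²defect≈0 h))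

Φ-equation : ∀ h → Φ h ≈ 1ˢ ⊕ 𝕫 ⊛ Φ (suc h) ⊕ 𝕫 ⊛ S h
Φ-equation h = SeriesRing.sym (x∙y⁻¹≈ε⇒x≈y _ (Φ h) (defect≈0 h))

Φ-coeff₀ : ∀ h → Φ h 0 ≡ + 1
Φ-coeff₀ h = trans (Φ-equation h 0) (cong₂ (λ u v → + 1 + u + v) (𝕫⊛-coeff₀ (Φ (suc h))) (𝕫⊛-coeff₀ (S h)))

Φ-coeff-suc : ∀ h k → Φ h (suc k) ≡ Φ (suc h) k + S h k
Φ-coeff-suc h k = begin
  Φ h (suc k)                                          ≡⟨ Φ-equation h (suc k) ⟩
  + 0 + (𝕫 ⊛ Φ (suc h)) (suc k) + (𝕫 ⊛ S h) (suc k)    ≡⟨ cong₂ (λ u v → + 0 + u + v) (𝕫⊛-suc (Φ (suc h)) k) (𝕫⊛-suc (S h) k) ⟩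
  + 0 + Φ (suc h) k + S h k                            ≡⟨ cong (_+ S h k) (ℤP.+-identityˡ (Φ (suc h) k)) ⟩
  Φ (suc h) k + S h k                                  ∎
  where open ≡-Reasoning

Φ₀-identity : Φ 0 ⊛ (𝕫 ⊛ X) ≈ (X ⊖ const (+ 1)) ⊛ (const (+ 1) ⊖ 𝕫 ⊛ X ⊕ 𝕫 ⊛ 𝕫 ⊛ X)
Φ₀-identity = x∙y⁻¹≈ε⇒x≈y _ _ (SeriesRing.trans difference
  (⊕-≈0ˢ X-isRoot (⊛-≈0ˢ (𝕫 ⊛ X) (⊖-≈0ˢ 𝕫⊛Φ₁))))
  where
  difference : Φ 0 ⊛ (𝕫 ⊛ X) ⊖ (X ⊖ const (+ 1)) ⊛ (const (+ 1) ⊖ 𝕫 ⊛ X ⊕ 𝕫 ⊛ 𝕫 ⊛ X)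
               ≈ cubic X ⊕ 𝕫 ⊛ X ⊛ (𝕫 ⊛ Φ₁ ⊖ (X ⊖ 1ˢ) ⊛ (1ˢ ⊖ 𝕫 ⊛ X))
  difference = solve 3
    (λ p x z →
       (con (+ 1) :+ z :* p) :* (z :* x) :- (x :- con (+ 1)) :* (con (+ 1) :- z :* x :+ z :* z :* x)
       := (con (+ 1) :- x :- z :* x :+ con (+ 2) :* z :* x :* x :+ z :* z :* x :- z :* z :* x :* x :* x)
          :+ z :* x :* (z :* p :- (x :- con (+ 1)) :* (con (+ 1) :- z :* x)))
    SeriesRing.refl Φ₁ X 𝕫

Ψ : ℕ → ℕ → Series
Ψ h i = Φ h ⊕ + i ·ˢ (𝕫 ⊛ Φ (suc h))

Ψ-coeff₀ : ∀ h i → Ψ h i 0 ≡ + 1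
Ψ-coeff₀ h i = begin
  Φ h 0 + + i * (𝕫 ⊛ Φ (suc h)) 0   ≡⟨ cong₂ (λ a b → a + + i * b) (Φ-coeff₀ h) (𝕫⊛-coeff₀ (Φ (suc h))) ⟩
  + 1 + + i * + 0                   ≡⟨ cong (_+_ (+ 1)) (ℤP.*-zeroʳ (+ i)) ⟩
  + 1                               ∎
  where open ≡-Reasoning

Ψ-coeff-suc : ∀ h i k → Ψ h i (suc k) ≡ + suc i * Φ (suc h) k + S h k
Ψ-coeff-suc h i k = begin
  Φ h (suc k) + + i * (𝕫 ⊛ Φ (suc h)) (suc k)   ≡⟨ cong₂ (λ a b → a + + i * b) (Φ-coeff-suc h k) (𝕫⊛-suc (Φ (suc h)) k) ⟩
  Φ (suc h) k + S h k + + i * Φ (suc h) k       ≡⟨ regroup (Φ (suc h) k) (S h k) (+ i) ⟩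
  + suc i * Φ (suc h) k + S h k                 ∎
  where
  open ≡-Reasoning
  regroup : ∀ a s i → a + s + i * a ≡ (+ 1 + i) * a + s
  regroup = solve-∀

Ψ-index₀ : ∀ h k → Ψ h 0 k ≡ Φ h k
Ψ-index₀ h k = trans (cong (_+_ (Φ h k)) (ℤP.*-zeroˡ ((𝕫 ⊛ Φ (suc h)) k))) (ℤP.+-identityʳ (Φ h k))

Ψ-index-suc : ∀ h i k → Ψ h (suc i) k ≡ Ψ h i k + (𝕫 ⊛ Φ (suc h)) k
Ψ-index-suc h i k = regroup (Φ h k) (+ i) ((𝕫 ⊛ Φ (suc h)) k)
  where
  regroup : ∀ a i z → a + (+ 1 + i) * z ≡ a + i * z + z
  regroup = solve-∀

𝕫⊛W-∑< : ∀ h k → (𝕫 ⊛ W h) k ≡ ∑< h (λ j → (𝕫 ⊛ Φ (suc (h ∸ j))) k)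
𝕫⊛W-∑< zero    k = trans (SeriesRing.zeroʳ 𝕫 k) (0ˢ-coeff k)
𝕫⊛W-∑< (suc h) k = trans (⊛-distribˡ 𝕫 (Φ (2 ℕ.+ h)) (W h) k)
                         (cong (_+_ ((𝕫 ⊛ Φ (2 ℕ.+ h)) k)) (𝕫⊛W-∑< h k))

S-∑< : ∀ h k → S h k ≡ ∑< h (λ j → Ψ (h ∸ j) j k)
S-∑< zero    k = 0ˢ-coeff k
S-∑< (suc h) k = begin
  Φ (suc h) k + S h k + (𝕫 ⊛ W h) k
    ≡⟨ cong₂ (λ s w → Φ (suc h) k + s + w) (S-∑< h k) (𝕫⊛W-∑< h k) ⟩
  Φ (suc h) k + ∑< h (λ j → Ψ (h ∸ j) j k) + ∑< h (λ j → (𝕫 ⊛ Φ (suc (h ∸ j))) k)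
    ≡⟨ ℤP.+-assoc (Φ (suc h) k) _ _ ⟩
  Φ (suc h) k + (∑< h (λ j → Ψ (h ∸ j) j k) + ∑< h (λ j → (𝕫 ⊛ Φ (suc (h ∸ j))) k))
    ≡⟨ cong₂ _+_ (sym (Ψ-index₀ (suc h) k))
                 (sym (∑<-+ h (λ j → Ψ (h ∸ j) j k) (λ j → (𝕫 ⊛ Φ (suc (h ∸ j))) k))) ⟩
  Ψ (suc h) 0 k + ∑< h (λ j → Ψ (h ∸ j) j k + (𝕫 ⊛ Φ (suc (h ∸ j))) k)
    ≡⟨ cong (_+_ (Ψ (suc h) 0 k)) (∑<-cong h (λ j _ → sym (Ψ-index-suc (h ∸ j) j k))) ⟩
  Ψ (suc h) 0 k + ∑< h (λ j → Ψ (h ∸ j) (suc j) k)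
    ∎
  where open ≡-Reasoning

-- Appending to avoiding sequences

Appendable : ∀ {n} → Vec ℕ n → ℕ → Set
Appendable {n} v x = ∀ (i j : Fin n) → i Fin.< j → lookup v j ≢ x → x ≤ lookup v i → ⊥

AllBelow : ∀ {n} → Vec ℕ n → ℕ → Set
AllBelow {n} v x = ∀ (i : Fin n) → lookup v i < x

data SnocView {n} : Fin (suc n) → Set where
  old : (i : Fin n) → SnocView (inject₁ i)
  new : SnocView (fromℕ n)

snocView : ∀ {n} (i : Fin (suc n)) → SnocView i
snocView {zero}  Fin.zero    = new
snocView {suc n} Fin.zero    = old Fin.zero
snocView {suc n} (Fin.suc i) with snocView i
... | old j = old (Fin.suc j)
... | new   = new

lookup-∷ʳ-old : ∀ {n} (v : Vec ℕ n) y i → lookup (v ∷ʳ y) (inject₁ i) ≡ lookup v i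
lookup-∷ʳ-old (_ ∷ v) y Fin.zero    = refl
lookup-∷ʳ-old (_ ∷ v) y (Fin.suc i) = lookup-∷ʳ-old v y i

lookup-∷ʳ-new : ∀ {n} (v : Vec ℕ n) y → lookup (v ∷ʳ y) (fromℕ n) ≡ y
lookup-∷ʳ-new []               y = refl
lookup-∷ʳ-new (_ ∷ v) y = lookup-∷ʳ-new v y

inject₁-< : ∀ {n} {i j : Fin n} → inject₁ i Fin.< inject₁ j ⇔ i Fin.< j
inject₁-< {i = i} {j} = mk⇔ (subst₂ _<_ (FinP.toℕ-inject₁ i) (FinP.toℕ-inject₁ j))
                            (subst₂ _<_ (sym (FinP.toℕ-inject₁ i)) (sym (FinP.toℕ-inject₁ j)))

old<new : ∀ {n} (i : Fin n) → inject₁ i Fin.< fromℕ n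
old<new {n} i = subst₂ _<_ (sym (FinP.toℕ-inject₁ i)) (sym (FinP.toℕ-fromℕ n)) (FinP.toℕ<n i)

new≮ : ∀ {n} (j : Fin (suc n)) → ¬ (fromℕ n Fin.< j)
new≮ j new<j = ℕP.<⇒≱ new<j (FinP.≤fromℕ j)

smaller-is-old : ∀ {n} {i j : Fin (suc n)} → i Fin.< j → Σ (Fin n) (λ i′ → i ≡ inject₁ i′)
smaller-is-old {i = i} {j} i<j with snocView i
... | old i′ = i′ , refl
... | new    = ⊥-elim (new≮ j i<j)

avoids-∷ʳ : ∀ {n} (v : Vec ℕ n) y → Avoids (v ∷ʳ y) ⇔ (Avoids v × Appendable v y)
avoids-∷ʳ {n} v y = mk⇔ to from
  where
  to : Avoids (v ∷ʳ y) → Avoids v × Appendable v y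
  to av = (λ i j k i<j j<k vj≢vk vk≤vi →
             av (inject₁ i) (inject₁ j) (inject₁ k)
                (Equivalence.from inject₁-< i<j) (Equivalence.from inject₁-< j<k)
                (subst₂ _≢_ (sym (lookup-∷ʳ-old v y j)) (sym (lookup-∷ʳ-old v y k)) vj≢vk)
                (subst₂ _≤_ (sym (lookup-∷ʳ-old v y k)) (sym (lookup-∷ʳ-old v y i)) vk≤vi))
        , (λ i j i<j vj≢y y≤vi →
             av (inject₁ i) (inject₁ j) (fromℕ n) (Equivalence.from inject₁-< i<j) (old<new j)
                (subst₂ _≢_ (sym (lookup-∷ʳ-old v y j)) (sym (lookup-∷ʳ-new v y)) vj≢y)
                (subst₂ _≤_ (sym (lookup-∷ʳ-new v y)) (sym (lookup-∷ʳ-old v y i)) y≤vi))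
  from : Avoids v × Appendable v y → Avoids (v ∷ʳ y)
  from (av , app) i j k i<j j<k vj≢vk vk≤vi
    with smaller-is-old i<j | smaller-is-old j<k | snocView k
  ... | i′ , refl | j′ , refl | old k′ =
    av i′ j′ k′ (Equivalence.to inject₁-< i<j) (Equivalence.to inject₁-< j<k)
       (subst₂ _≢_ (lookup-∷ʳ-old v y j′) (lookup-∷ʳ-old v y k′) vj≢vk)
       (subst₂ _≤_ (lookup-∷ʳ-old v y k′) (lookup-∷ʳ-old v y i′) vk≤vi)
  ... | i′ , refl | j′ , refl | new =
    app i′ j′ (Equivalence.to inject₁-< i<j)
        (subst₂ _≢_ (lookup-∷ʳ-old v y j′) (lookup-∷ʳ-new v y) vj≢vk)
        (subst₂ _≤_ (lookup-∷ʳ-new v y) (lookup-∷ʳ-old v y i′) vk≤vi)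

appendable-∷ʳ : ∀ {n} (v : Vec ℕ n) y x → Appendable (v ∷ʳ y) x ⇔ (Appendable v x × (y ≡ x ⊎ AllBelow v x))
appendable-∷ʳ {n} v y x = mk⇔ to from
  where
  to : Appendable (v ∷ʳ y) x → Appendable v x × (y ≡ x ⊎ AllBelow v x)
  to app = (λ i j i<j vj≢x x≤vi →
              app (inject₁ i) (inject₁ j) (Equivalence.from inject₁-< i<j)
                  (subst (_≢ x) (sym (lookup-∷ʳ-old v y j)) vj≢x)
                  (subst (x ≤_) (sym (lookup-∷ʳ-old v y i)) x≤vi))
         , new-entry
    where
    new-entry : y ≡ x ⊎ AllBelow v x
    new-entry with y ≟ x
    ... | yes y≡x = inj₁ y≡x
    ... | no  y≢x = inj₂ λ i → ℕP.≰⇒> λ x≤vi →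
      app (inject₁ i) (fromℕ n) (old<new i)
          (subst (_≢ x) (sym (lookup-∷ʳ-new v y)) y≢x)
          (subst (x ≤_) (sym (lookup-∷ʳ-old v y i)) x≤vi)
  from : Appendable v x × (y ≡ x ⊎ AllBelow v x) → Appendable (v ∷ʳ y) x
  from (app , new-entry) i j i<j vj≢x x≤vi with smaller-is-old i<j | snocView j
  ... | i′ , refl | old j′ =
    app i′ j′ (Equivalence.to inject₁-< i<j)
        (subst (_≢ x) (lookup-∷ʳ-old v y j′) vj≢x)
        (subst (x ≤_) (lookup-∷ʳ-old v y i′) x≤vi)
  ... | i′ , refl | new with new-entry
  ...   | inj₁ y≡x    = vj≢x (trans (lookup-∷ʳ-new v y) y≡x)
  ...   | inj₂ below = ℕP.<⇒≱ (below i′) (subst (x ≤_) (lookup-∷ʳ-old v y i′) x≤vi)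

allBelow-∷ʳ : ∀ {n} (v : Vec ℕ n) y x → AllBelow (v ∷ʳ y) x ⇔ (AllBelow v x × y < x)
allBelow-∷ʳ {n} v y x = mk⇔ to from
  where
  to : AllBelow (v ∷ʳ y) x → AllBelow v x × y < x
  to below = (λ i → subst (_< x) (lookup-∷ʳ-old v y i) (below (inject₁ i)))
           , subst (_< x) (lookup-∷ʳ-new v y) (below (fromℕ n))
  from : AllBelow v x × y < x → AllBelow (v ∷ʳ y) x
  from (below , y<x) i with snocView i
  ... | old i′ = subst (_< x) (sym (lookup-∷ʳ-old v y i′)) (below i′)
  ... | new    = subst (_< x) (sym (lookup-∷ʳ-new v y)) y<x

data State : Set where
  ray   : (lo top : ℕ) → State
  rayOr : (top L : ℕ) → State

top : State → ℕ
top (ray _ t)   = t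
top (rayOr t _) = t

Admissible : State → ℕ → Set
Admissible (ray lo _)  x = lo ≤ x
Admissible (rayOr t L) x = t ≤ x ⊎ x ≡ L

admissible? : ∀ s x → Dec (Admissible s x)
admissible? (ray lo _)  x = lo ≤? x
admissible? (rayOr t L) x = (t ≤? x) ⊎-dec (x ≟ L)

WellFormed : State → Set
WellFormed (ray lo t)  = lo ≤ t
WellFormed (rayOr t L) = L < t

stepBelow : State → ℕ → State
stepBelow (ray _ t)   y = rayOr t y
stepBelow (rayOr t L) _ = rayOr t L

step : State → ℕ → State
step s y = if does (top s ≤? y) then ray (top s) (suc y) else stepBelow s y

step-≥ : ∀ s {y} → top s ≤ y → step s y ≡ ray (top s) (suc y)
step-≥ s {y} t≤y rewrite dec-true (top s ≤? y) t≤y = refl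

step-< : ∀ s {y} → y < top s → step s y ≡ stepBelow s y
step-< s {y} y<t rewrite dec-false (top s ≤? y) (ℕP.<⇒≱ y<t) = refl

admissible-above : ∀ s {x} → WellFormed s → top s ≤ x → Admissible s x
admissible-above (ray lo t)  lo≤t t≤x = ℕP.≤-trans lo≤t t≤x
admissible-above (rayOr t L) _    t≤x = inj₁ t≤x

step-wellFormed : ∀ s y → WellFormed s → WellFormed (step s y)
step-wellFormed s y wf with top s ≤? y
... | yes t≤y rewrite step-≥ s t≤y = ℕP.m≤n⇒m≤1+n t≤y
step-wellFormed (ray lo t)  y wf | no t≰y rewrite step-< (ray lo t) (ℕP.≰⇒> t≰y) = ℕP.≰⇒> t≰y
step-wellFormed (rayOr t L) y wf | no t≰y rewrite step-< (rayOr t L) (ℕP.≰⇒> t≰y) = wf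

step-admissible : ∀ s y x → WellFormed s → Admissible s y →
                  Admissible (step s y) x ⇔ (Admissible s x × (y ≡ x ⊎ top s ≤ x))
step-admissible s y x wf adm-y with top s ≤? y
... | yes t≤y rewrite step-≥ s t≤y =
  mk⇔ (λ t≤x → admissible-above s wf t≤x , inj₂ t≤x)
      (λ { (_ , inj₁ refl) → t≤y ; (_ , inj₂ t≤x) → t≤x })
step-admissible (ray lo t) y x wf adm-y | no t≰y rewrite step-< (ray lo t) (ℕP.≰⇒> t≰y) =
  mk⇔ (λ { (inj₁ t≤x) → ℕP.≤-trans wf t≤x , inj₂ t≤x ; (inj₂ refl) → adm-y , inj₁ refl })
      (λ { (_ , inj₁ refl) → inj₂ refl ; (_ , inj₂ t≤x) → inj₁ t≤x })
step-admissible (rayOr t L) y x wf (inj₁ t≤y) | no t≰y = ⊥-elim (t≰y t≤y)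
step-admissible (rayOr t L) y x wf (inj₂ refl) | no t≰y rewrite step-< (rayOr t y) (ℕP.≰⇒> t≰y) =
  mk⇔ (λ { (inj₁ t≤x) → inj₁ t≤x , inj₂ t≤x ; (inj₂ refl) → inj₂ refl , inj₁ refl })
      proj₁

top-stepBelow : ∀ s y → top (stepBelow s y) ≡ top s
top-stepBelow (ray _ _)   _ = refl
top-stepBelow (rayOr _ _) _ = refl

top-step : ∀ s y x → top (step s y) ≤ x ⇔ (top s ≤ x × y < x)
top-step s y x with top s ≤? y
... | yes t≤y rewrite step-≥ s t≤y =
  mk⇔ (λ y<x → ℕP.≤-trans t≤y (ℕP.<⇒≤ y<x) , y<x) proj₂
... | no t≰y rewrite step-< s (ℕP.≰⇒> t≰y) | top-stepBelow s y =
  mk⇔ (λ t≤x → t≤x , ℕP.<-≤-trans (ℕP.≰⇒> t≰y) t≤x) proj₁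

record Tracks {n} (v : Vec ℕ n) (s : State) : Set where
  field
    wellFormed : WellFormed s
    appendable : ∀ x → Appendable v x ⇔ Admissible s x
    allBelow   : ∀ x → AllBelow v x ⇔ top s ≤ x

tracks-[] : Tracks [] (ray 0 0)
tracks-[] = record
  { wellFormed = z≤n
  ; appendable = λ x → mk⇔ (λ _ → z≤n) (λ _ ())
  ; allBelow   = λ x → mk⇔ (λ _ → z≤n) (λ _ ())
  }

tracks-∷ʳ : ∀ {n} {v : Vec ℕ n} {s} y → Tracks v s → Appendable v y → Tracks (v ∷ʳ y) (step s y)
tracks-∷ʳ {v = v} {s} y tracks app-y = record
  { wellFormed = step-wellFormed s y wellFormed
  ; appendable = λ x →
      ⇔.trans (appendable-∷ʳ v y x)
      (⇔.trans (appendable x ×-⇔ (⇔-id (y ≡ x) ⊎-⇔ allBelow x))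
               (⇔.sym (step-admissible s y x wellFormed adm-y)))
  ; allBelow = λ x →
      ⇔.trans (allBelow-∷ʳ v y x)
      (⇔.trans (allBelow x ×-⇔ ⇔-id (y < x))
               (⇔.sym (top-step s y x)))
  }
  where
  open Tracks tracks
  adm-y : Admissible s y
  adm-y = Equivalence.to (appendable y) app-y

state : ∀ {n} → Vec ℕ n → State
state = foldl′ step (ray 0 0)

state-∷ʳ : ∀ {n} (v : Vec ℕ n) y → state (v ∷ʳ y) ≡ step (state v) y
state-∷ʳ v y = VecP.foldl-∷ʳ (λ _ → State) step (ray 0 0) y v

tracks-state : ∀ {n} (v : Vec ℕ n) → Avoids v → Tracks v (state v)
tracks-state []    _ = tracks-[]
tracks-state {suc n} v av with initLast v
... | u , y , refl = subst (Tracks (u ∷ʳ y)) (sym (state-∷ʳ u y))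
                           (tracks-∷ʳ y (tracks-state u (proj₁ split)) (proj₂ split))
  where
  split : Avoids u × Appendable u y
  split = Equivalence.to (avoids-∷ʳ u y) av

avoids-∷ʳ-state : ∀ {n} {v : Vec ℕ n} x → Avoids v → Avoids (v ∷ʳ x) ⇔ Admissible (state v) x
avoids-∷ʳ-state {v = v} x av =
  ⇔.trans (avoids-∷ʳ v x)
  (⇔.trans (mk⇔ proj₂ (av ,_)) (Tracks.appendable (tracks-state v av) x))

-- Counting avoiding sequences

appendWeight : (State → ℕ) → State → ℕ → ℕ
appendWeight g s x = if does (admissible? s x) then g (step s x) else 0

extend : (State → ℕ) → State → ℕ → ℕ
extend g s m = sum (map (appendWeight g s) (upTo (suc m)))

appendWeight-admissible : ∀ g s {x} → Admissible s x → appendWeight g s x ≡ g (step s x)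
appendWeight-admissible g s {x} adm rewrite dec-true (admissible? s x) adm = refl

appendWeight-inadmissible : ∀ g s {x} → ¬ Admissible s x → appendWeight g s x ≡ 0
appendWeight-inadmissible g s {x} ¬adm rewrite dec-false (admissible? s x) ¬adm = refl

∑avoiding : ℕ → (State → ℕ) → ℕ
∑avoiding n g = sum (map (λ v → if does (avoids? v) then g (state v) else 0) (invSeqs n))

∑avoiding-suc : ∀ n g → ∑avoiding (suc n) g ≡ ∑avoiding n (λ s → extend g s n)
∑avoiding-suc n g =
  trans (sum-map-concatMap weight (λ v → map (v ∷ʳ_) (upTo (suc n))) (invSeqs n))
        (cong sum (ListP.map-cong extensions (invSeqs n)))
  where
  weight : ∀ {m} → Vec ℕ m → ℕ
  weight v = if does (avoids? v) then g (state v) else 0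
  extensions : ∀ v → sum (map weight (map (v ∷ʳ_) (upTo (suc n))))
                     ≡ (if does (avoids? v) then extend g (state v) n else 0)
  extensions v with avoids? v
  ... | yes av = begin
    sum (map weight (map (v ∷ʳ_) (upTo (suc n))))          ≡⟨ cong sum (sym (ListP.map-∘ (upTo (suc n)))) ⟩
    sum (map (weight ∘ (v ∷ʳ_)) (upTo (suc n)))            ≡⟨ cong sum (ListP.map-cong entry (upTo (suc n))) ⟩
    extend g (state v) n                                   ≡⟨ cong (λ b → if b then extend g (state v) n else 0)
                                                                   (sym (dec-true (avoids? v) av)) ⟩
    (if does (avoids? v) then extend g (state v) n else 0) ∎
    where
    open ≡-Reasoning
    entry : ∀ x → weight (v ∷ʳ x) ≡ appendWeight g (state v) x
    entry x = cong₂ (λ b s → if b then g s else 0)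
                    (does-⇔ (avoids-∷ʳ-state {v = v} x av) (avoids? (v ∷ʳ x)) (admissible? (state v) x))
                    (state-∷ʳ v x)
  ... | no ¬av = begin
    sum (map weight (map (v ∷ʳ_) (upTo (suc n))))          ≡⟨ cong sum (sym (ListP.map-∘ (upTo (suc n)))) ⟩
    sum (map (weight ∘ (v ∷ʳ_)) (upTo (suc n)))            ≡⟨ sum-map-zero (weight ∘ (v ∷ʳ_)) (upTo (suc n)) entry ⟩
    0                                                      ≡⟨ cong (λ b → if b then extend g (state v) n else 0)
                                                                   (sym (dec-false (avoids? v) ¬av)) ⟩
    (if does (avoids? v) then extend g (state v) n else 0) ∎
    where
    open ≡-Reasoning
    entry : ∀ x → weight (v ∷ʳ x) ≡ 0
    entry x = cong (λ b → if b then g (state (v ∷ʳ x)) else 0)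
                   (dec-false (avoids? (v ∷ʳ x)) (¬av ∘ proj₁ ∘ Equivalence.to (avoids-∷ʳ v x)))

-- Completions by k entries of an avoiding sequence of length m in state s.
count : ℕ → State → ℕ → ℕ
count zero    s m = 1
count (suc k) s m = extend (λ s′ → count k s′ (suc m)) s m

∑avoiding-count : ∀ n k → ∑avoiding n (λ s → count k s n) ≡ count (n ℕ.+ k) (ray 0 0) 0
∑avoiding-count zero k with avoids? []
... | yes _   = ℕP.+-identityʳ _
... | no ¬av = ⊥-elim (¬av λ ())
∑avoiding-count (suc n) k = begin
  ∑avoiding (suc n) (λ s → count k s (suc n))   ≡⟨ ∑avoiding-suc n (λ s → count k s (suc n)) ⟩
  ∑avoiding n (λ s → count (suc k) s n)         ≡⟨ ∑avoiding-count n (suc k) ⟩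
  count (n ℕ.+ suc k) (ray 0 0) 0               ≡⟨ cong (λ t → count t (ray 0 0) 0) (ℕP.+-suc n k) ⟩
  count (suc n ℕ.+ k) (ray 0 0) 0               ∎
  where open ≡-Reasoning

I≡count : ∀ n → I n ≡ count n (ray 0 0) 0
I≡count n = begin
  I n                                   ≡⟨ length-filter avoids? (invSeqs n) ⟩
  ∑avoiding n (λ s → count 0 s n)       ≡⟨ ∑avoiding-count n 0 ⟩
  count (n ℕ.+ 0) (ray 0 0) 0           ≡⟨ cong (λ t → count t (ray 0 0) 0) (ℕP.+-identityʳ n) ⟩
  count n (ray 0 0) 0                   ∎
  where open ≡-Reasoning

m+1+n≡1+m+k+[n∸k] : ∀ m k n → k ≤ n → m ℕ.+ suc n ≡ suc (m ℕ.+ k) ℕ.+ (n ∸ k)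
m+1+n≡1+m+k+[n∸k] m k n k≤n = begin
  m ℕ.+ suc n                    ≡⟨ cong (λ l → m ℕ.+ suc l) (sym (ℕP.m+[n∸m]≡n k≤n)) ⟩
  m ℕ.+ suc (k ℕ.+ (n ∸ k))      ≡⟨ ℕP.+-suc m _ ⟩
  suc (m ℕ.+ (k ℕ.+ (n ∸ k)))    ≡⟨ cong suc (sym (ℕP.+-assoc m k (n ∸ k))) ⟩
  suc (m ℕ.+ k ℕ.+ (n ∸ k))      ∎
  where open ≡-Reasoning

count-ray   : ∀ k {lo t m} i h → t ≡ lo ℕ.+ suc i → m ≡ t ℕ.+ h → + count k (ray lo t) m ≡ Ψ (suc h) i k
count-rayOr : ∀ k {t L m} h → L < t → m ≡ t ℕ.+ h → + count k (rayOr t L) m ≡ Φ (suc h) k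
count-above : ∀ k s {m} h → WellFormed s → suc m ≡ top s ℕ.+ suc h →
              ∑< (suc h) (λ j → + appendWeight (λ s′ → count k s′ (suc m)) s (top s ℕ.+ j)) ≡ S (suc h) k

count-ray zero i h _ _ = sym (Ψ-coeff₀ (suc h) i)
count-ray (suc k) {lo} {t} {m} i h t≡ m≡ = begin
  + count (suc k) (ray lo t) m                  ≡⟨ sum-upTo (suc m) (appendWeight g (ray lo t)) ⟩
  ∑< (suc m) F                                  ≡⟨ cong (λ n → ∑< n F) range ⟩
  ∑< (t ℕ.+ suc h) F                            ≡⟨ ∑<-++ t (suc h) F ⟩
  ∑< t F + ∑< (suc h) (λ j → F (t ℕ.+ j))       ≡⟨ cong₂ _+_ below-top (count-above k (ray lo t) h lo≤t range) ⟩
  + suc i * Φ (2 ℕ.+ h) k + S (suc h) k         ≡⟨ sym (Ψ-coeff-suc (suc h) i k) ⟩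
  Ψ (suc h) i (suc k)                           ∎
  where
  open ≡-Reasoning
  g : State → ℕ
  g s′ = count k s′ (suc m)
  F : ℕ → ℤ
  F x = + appendWeight g (ray lo t) x
  range : suc m ≡ t ℕ.+ suc h
  range = trans (cong suc m≡) (sym (ℕP.+-suc t h))
  lo≤t : lo ≤ t
  lo≤t = subst (lo ≤_) (sym t≡) (ℕP.m≤m+n lo (suc i))
  inadmissible : ∀ x → x < lo → F x ≡ + 0
  inadmissible x x<lo = cong +_ (appendWeight-inadmissible g (ray lo t) (ℕP.<⇒≱ x<lo))
  between : ∀ j → j < suc i → F (lo ℕ.+ j) ≡ Φ (2 ℕ.+ h) k
  between j j<1+i = begin
    + appendWeight g (ray lo t) (lo ℕ.+ j)          ≡⟨ cong +_ (appendWeight-admissible g (ray lo t) (ℕP.m≤m+n lo j)) ⟩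
    + count k (step (ray lo t) (lo ℕ.+ j)) (suc m)  ≡⟨ cong (λ s → + count k s (suc m)) (step-< (ray lo t) x<t) ⟩
    + count k (rayOr t (lo ℕ.+ j)) (suc m)          ≡⟨ count-rayOr k (suc h) x<t range ⟩
    Φ (2 ℕ.+ h) k                                   ∎
    where
    x<t : lo ℕ.+ j < t
    x<t = subst (lo ℕ.+ j <_) (sym t≡) (ℕP.+-monoʳ-< lo j<1+i)
  below-top : ∑< t F ≡ + suc i * Φ (2 ℕ.+ h) k
  below-top = begin
    ∑< t F                                          ≡⟨ cong (λ n → ∑< n F) t≡ ⟩
    ∑< (lo ℕ.+ suc i) F                             ≡⟨ ∑<-++ lo (suc i) F ⟩
    ∑< lo F + ∑< (suc i) (λ j → F (lo ℕ.+ j))       ≡⟨ cong₂ _+_ (∑<-zero lo inadmissible) (∑<-cong (suc i) between) ⟩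
    + 0 + ∑< (suc i) (λ _ → Φ (2 ℕ.+ h) k)          ≡⟨ ℤP.+-identityˡ _ ⟩
    ∑< (suc i) (λ _ → Φ (2 ℕ.+ h) k)                ≡⟨ ∑<-const (suc i) (Φ (2 ℕ.+ h) k) ⟩
    + suc i * Φ (2 ℕ.+ h) k                         ∎

count-rayOr zero h _ _ = sym (Φ-coeff₀ (suc h))
count-rayOr (suc k) {t} {L} {m} h L<t m≡ = begin
  + count (suc k) (rayOr t L) m                 ≡⟨ sum-upTo (suc m) (appendWeight g (rayOr t L)) ⟩
  ∑< (suc m) F                                  ≡⟨ cong (λ n → ∑< n F) range ⟩
  ∑< (t ℕ.+ suc h) F                            ≡⟨ ∑<-++ t (suc h) F ⟩
  ∑< t F + ∑< (suc h) (λ j → F (t ℕ.+ j))       ≡⟨ cong₂ _+_ (∑<-point F L<t inadmissible) (count-above k (rayOr t L) h L<t range) ⟩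
  F L + S (suc h) k                             ≡⟨ cong (_+ S (suc h) k) at-L ⟩
  Φ (2 ℕ.+ h) k + S (suc h) k                   ≡⟨ sym (Φ-coeff-suc (suc h) k) ⟩
  Φ (suc h) (suc k)                             ∎
  where
  open ≡-Reasoning
  g : State → ℕ
  g s′ = count k s′ (suc m)
  F : ℕ → ℤ
  F x = + appendWeight g (rayOr t L) x
  range : suc m ≡ t ℕ.+ suc h
  range = trans (cong suc m≡) (sym (ℕP.+-suc t h))
  inadmissible : ∀ x → x < t → x ≢ L → F x ≡ + 0
  inadmissible x x<t x≢L = cong +_ (appendWeight-inadmissible g (rayOr t L)
                                     λ { (inj₁ t≤x) → ℕP.<⇒≱ x<t t≤x ; (inj₂ x≡L) → x≢L x≡L })
  at-L : F L ≡ Φ (2 ℕ.+ h) k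
  at-L = begin
    + appendWeight g (rayOr t L) L                  ≡⟨ cong +_ (appendWeight-admissible g (rayOr t L) (inj₂ refl)) ⟩
    + count k (step (rayOr t L) L) (suc m)          ≡⟨ cong (λ s → + count k s (suc m)) (step-< (rayOr t L) L<t) ⟩
    + count k (rayOr t L) (suc m)                   ≡⟨ count-rayOr k (suc h) L<t range ⟩
    Φ (2 ℕ.+ h) k                                   ∎

count-above k s {m} h wf range = begin
  ∑< (suc h) (λ j → + appendWeight g s (top s ℕ.+ j))   ≡⟨ ∑<-cong (suc h) entry ⟩
  ∑< (suc h) (λ j → Ψ (suc h ∸ j) j k)                   ≡⟨ sym (S-∑< (suc h) k) ⟩
  S (suc h) k                                            ∎
  where
  open ≡-Reasoning
  g : State → ℕ
  g s′ = count k s′ (suc m)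
  entry : ∀ j → j < suc h → + appendWeight g s (top s ℕ.+ j) ≡ Ψ (suc h ∸ j) j k
  entry j (s≤s j≤h) = begin
    + appendWeight g s (top s ℕ.+ j)                      ≡⟨ cong +_ (appendWeight-admissible g s (admissible-above s wf t≤x)) ⟩
    + count k (step s (top s ℕ.+ j)) (suc m)              ≡⟨ cong (λ s′ → + count k s′ (suc m)) (step-≥ s t≤x) ⟩
    + count k (ray (top s) (suc (top s ℕ.+ j))) (suc m)   ≡⟨ count-ray k j (h ∸ j) (sym (ℕP.+-suc (top s) j))
                                                                      (trans range (m+1+n≡1+m+k+[n∸k] (top s) j h j≤h)) ⟩
    Ψ (suc (h ∸ j)) j k                                   ≡⟨ cong (λ h′ → Ψ h′ j k) (sym (ℕP.+-∸-assoc 1 j≤h)) ⟩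
    Ψ (suc h ∸ j) j k                                     ∎
    where
    t≤x : top s ≤ top s ℕ.+ j
    t≤x = ℕP.m≤m+n (top s) j

count-start : ∀ k → + count k (ray 0 0) 0 ≡ Φ 0 k
count-start zero    = sym (Φ-coeff₀ 0)
-- The only possible first entry is 0, which leads to the state ray 0 1.
count-start (suc k) = begin
  + count (suc k) (ray 0 0) 0   ≡⟨ cong +_ (ℕP.+-identityʳ _) ⟩
  + count k (ray 0 1) 1         ≡⟨ count-ray k 0 0 refl refl ⟩
  Ψ 1 0 k                       ≡⟨ Ψ-index₀ 1 k ⟩
  Φ 1 k                         ≡⟨ sym (ℤP.+-identityʳ (Φ 1 k)) ⟩
  Φ 1 k + + 0                   ≡⟨ cong (_+_ (Φ 1 k)) (sym (0ˢ-coeff k)) ⟩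
  Φ 1 k + S 0 k                 ≡⟨ sym (Φ-coeff-suc 0 k) ⟩
  Φ 0 (suc k)                   ∎
  where open ≡-Reasoning

ogf-I : ogf I ≈ Φ 0
ogf-I n = trans (cong +_ (I≡count n)) (count-start n)

mainTheorem4 : Σ Series (λ X → IsRoot X × (∀ Y → IsRoot Y → Y ≈ X)
                 × (ogf I ⊛ (𝕫 ⊛ X) ≈ (X ⊖ const (+ 1)) ⊛ (const (+ 1) ⊖ 𝕫 ⊛ X ⊕ 𝕫 ⊛ 𝕫 ⊛ X)))
mainTheorem4 =
  X , X-isRoot , X-unique , SeriesRing.trans (⊛-cong {g = 𝕫 ⊛ X} ogf-I SeriesRing.refl) Φ₀-identity
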